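{- Let $A\subseteq\omega$ be $m$-rigid. Then $\deg_m(A)$ contains an infinite antichain of finite-one degrees: there are sets $B_0,B_1,\dots$, each with $B_k\equiv_m A$, such that $B_i\not\le_{fin}B_j$ for all $i\ne j$.
   Context: A set $A$ is $m$-rigid if for every total computable $f$ with $x\in A\iff f(x)\in A$ for all $x$, $f(x)=x$ for all but finitely many $x$. $X\le_m Y$: there is a total computable $f$ with $x\in X\iff f(x)\in Y$; $X\le_{fin}Y$: the same with $f$ finite-to-one ($|f^{ -1}(y)|<\infty$ for all $y$). $\equiv_m$ is mutual $\le_m$-reducibility and $\deg_m(A)=\{B:B\equiv_m A\}$. -}

module Defs where

open import Data.Nat using (ℕ; zero; suc; _<_; _≥_)
open import Data.Fin using (Fin)
open import Data.Vec using (Vec; []; _∷_; lookup)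
open import Relation.Binary.PropositionalEquality using (_≡_)
open import Data.Product using (Σ; ∃; _×_; _,_)

data PR : ℕ → Set where
  Z : ∀ {n} → PR n
  S : PR 1
  P : ∀ {n} → Fin n → PR n
  C : ∀ {n k} → PR k → Vec (PR n) k → PR n
  R : ∀ {n} → PR n → PR (suc (suc n)) → PR (suc n)   -- primitive recursion (on 1st arg)
  M : ∀ {n} → PR (suc n) → PR n

mutual
  data _⟦_⟧⇓_ : ∀ {n} → PR n → Vec ℕ n → ℕ → Set where
    evZ : ∀ {n} {xs : Vec ℕ n} → Z ⟦ xs ⟧⇓ 0
    evS : ∀ {x} → S ⟦ x ∷ [] ⟧⇓ suc x
    evP : ∀ {n} {i : Fin n} {xs} → P i ⟦ xs ⟧⇓ lookup xs i
    evC : ∀ {n k} {f : PR k} {gs : Vec (PR n) k} {xs ys y} →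
          gs ⟦ xs ⟧⇓* ys → f ⟦ ys ⟧⇓ y → C f gs ⟦ xs ⟧⇓ y
    evR0 : ∀ {n} {f : PR n} {g} {xs y} →
           f ⟦ xs ⟧⇓ y → R f g ⟦ 0 ∷ xs ⟧⇓ y
    evRS : ∀ {n} {f : PR n} {g} {xs m r y} →
           R f g ⟦ m ∷ xs ⟧⇓ r → g ⟦ m ∷ r ∷ xs ⟧⇓ y → R f g ⟦ suc m ∷ xs ⟧⇓ y
    evM : ∀ {n} {f : PR (suc n)} {xs y} →
          f ⟦ y ∷ xs ⟧⇓ 0 →
          (∀ z → z < y → ∃ λ w → f ⟦ z ∷ xs ⟧⇓ suc w) →
          M f ⟦ xs ⟧⇓ y

  data _⟦_⟧⇓*_ : ∀ {n k} → Vec (PR n) k → Vec ℕ n → Vec ℕ k → Set where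
    ev[] : ∀ {n} {xs : Vec ℕ n} → [] ⟦ xs ⟧⇓* []
    ev∷ : ∀ {n k} {g : PR n} {gs : Vec (PR n) k} {xs y ys} →
          g ⟦ xs ⟧⇓ y → gs ⟦ xs ⟧⇓* ys → (g ∷ gs) ⟦ xs ⟧⇓* (y ∷ ys)

Computable : (ℕ → ℕ) → Set
Computable f = Σ (PR 1) λ e → ∀ x → e ⟦ x ∷ [] ⟧⇓ f x

SubsetOfω : Set₁
SubsetOfω = ℕ → Set

_⇔_ : Set → Set → Set
X ⇔ Y = (X → Y) × (Y → X)

Reduces : (ℕ → ℕ) → SubsetOfω → SubsetOfω → Set
Reduces f X Y = ∀ x → X x ⇔ Y (f x)

AlmostIdentity : (ℕ → ℕ) → Set
AlmostIdentity f = ∃ λ N → ∀ x → x ≥ N → f x ≡ x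

FiniteToOne : (ℕ → ℕ) → Set
FiniteToOne f = ∀ y → ∃ λ N → ∀ x → f x ≡ y → x < N

mRigid : SubsetOfω → Set
mRigid A = ∀ f → Computable f → Reduces f A A → AlmostIdentity f

_≤m_ : SubsetOfω → SubsetOfω → Set
X ≤m Y = Σ (ℕ → ℕ) λ f → Computable f × Reduces f X Y

_≤fin_ : SubsetOfω → SubsetOfω → Set
X ≤fin Y = Σ (ℕ → ℕ) λ f → Computable f × FiniteToOne f × Reduces f X Y

_≡m_ : SubsetOfω → SubsetOfω → Set
X ≡m Y = (X ≤m Y) × (Y ≤m X)

-- Fix a computable h all of whose fibres are infinite (a sawtooth will do). Let B k contain A on
-- the even numbers (2y ∈ B k ⇔ y ∈ A) and, on the odd number 2m+1, ask whether h m ∈ A when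
-- h (h m) = k (and whether a fixed element of h⁻¹(k) is in A otherwise); so B k ≡m A, and its odd
-- part holds infinitely many copies of A restricted to h⁻¹(k).
-- Given a finite-to-one reduction g of B i to B j with i ≢ j, for x ∈ h⁻¹(i) search for m ∈ h⁻¹(x)
-- with g (2m+1) ≢ 2x; one exists because h⁻¹(x) is infinite and g⁻¹(2x) finite. Sending such x to
-- 2m+1 and every other x to 2x, then applying g and decoding B j, reduces A to itself. On h⁻¹(i)
-- this reduction moves every point: odd values of g decode into h⁻¹(j), and even values were
-- excluded by the choice of m. As h⁻¹(i) is infinite, this contradicts rigidity of A.

module Submission where

open import Defs
open import Data.Nat using (ℕ; zero; suc; _+_; _∸_; _<_; _≤_; pred; ∣_-_∣; z≤n; s≤s; s≤s⁻¹; _≟_)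
open import Data.Nat.Properties
open import Data.Fin using (Fin; #_) renaming (zero to fzero; suc to fsuc)
open import Data.Vec using (Vec; []; _∷_; lookup; map)
open import Data.Vec.Relation.Unary.All using (All; []; _∷_)
open import Data.Vec.N-ary using (N-ary)
open import Data.Product using (∃; Σ; _×_; _,_; proj₁; proj₂)
open import Data.Sum using (_⊎_; inj₁; inj₂)
open import Data.Empty using (⊥; ⊥-elim)
open import Function using (_∘_; id)
open import Relation.Binary.PropositionalEquality
open import Relation.Nullary using (¬_; yes; no)
open import Relation.Unary using (Decidable)

open ≡-Reasoning

Computableⁿ : (n : ℕ) → (Vec ℕ n → ℕ) → Set
Computableⁿ n f = Σ (PR n) λ e → ∀ xs → e ⟦ xs ⟧⇓ f xs

-- Arguments are read with `lookup`, exactly as projections `P i` read them,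
-- so composites of computable functions reduce to the intended terms.
_$ᶠ_ : ∀ {n} → N-ary n ℕ ℕ → (Fin n → ℕ) → ℕ
_$ᶠ_ {zero}  f σ = f
_$ᶠ_ {suc n} f σ = f (σ fzero) $ᶠ (σ ∘ fsuc)

uncurryⁿ : ∀ n → N-ary n ℕ ℕ → Vec ℕ n → ℕ
uncurryⁿ n f xs = f $ᶠ lookup xs

Computable[_] : ∀ n → N-ary n ℕ ℕ → Set
Computable[ n ] f = Computableⁿ n (uncurryⁿ n f)

Computable→Computable[1] : ∀ {f} → Computable f → Computable[ 1 ] f
Computable→Computable[1] (e , ev) = e , λ { (x ∷ []) → ev x }

Computable[1]→Computable : ∀ {f} → Computable[ 1 ] f → Computable f
Computable[1]→Computable (e , ev) = e , λ x → ev (x ∷ [])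

computable-ext : ∀ {n} {f g : Vec ℕ n → ℕ} →
                 Computableⁿ n f → (∀ xs → f xs ≡ g xs) → Computableⁿ n g
computable-ext (e , ev) f≗g = e , λ xs → subst (e ⟦ xs ⟧⇓_) (f≗g xs) (ev xs)

lookup-computable : ∀ {n} (i : Fin n) → Computableⁿ n (λ xs → lookup xs i)
lookup-computable i = P i , λ xs → evP

x₀ : ∀ {n} → Computableⁿ (suc n) (λ xs → lookup xs fzero)
x₀ = lookup-computable fzero

x₁ : ∀ {n} → Computableⁿ (suc (suc n)) (λ xs → lookup xs (fsuc fzero))
x₁ = lookup-computable (fsuc fzero)

suc-computable : Computable[ 1 ] suc
suc-computable = S , λ { (x ∷ []) → evS }

module _ {n : ℕ} where

  programs : ∀ {k} {gs : Vec (Vec ℕ n → ℕ) k} → All (Computableⁿ n) gs → Vec (PR n) k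
  programs []               = []
  programs ((e , _) ∷ cgs) = e ∷ programs cgs

  programs-evaluate : ∀ {k} {gs : Vec (Vec ℕ n → ℕ) k} (cgs : All (Computableⁿ n) gs) xs →
                      programs cgs ⟦ xs ⟧⇓* map (λ g → g xs) gs
  programs-evaluate []               xs = ev[]
  programs-evaluate ((_ , ev) ∷ cgs) xs = ev∷ (ev xs) (programs-evaluate cgs xs)

infixr 9 _∘ᶜ_
_∘ᶜ_ : ∀ {n k} {f : Vec ℕ k → ℕ} {gs : Vec (Vec ℕ n → ℕ) k} →
       Computableⁿ k f → All (Computableⁿ n) gs → Computableⁿ n (λ xs → f (map (λ g → g xs) gs))
(e , ev) ∘ᶜ cgs = C e (programs cgs) , λ xs → evC (programs-evaluate cgs xs) (ev _)

const-computable : ∀ {n} k → Computableⁿ n (λ _ → k)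
const-computable zero    = Z , λ _ → evZ
const-computable (suc k) = suc-computable ∘ᶜ (const-computable k ∷ [])

primrec-computable : ∀ {n} (f : N-ary (suc n) ℕ ℕ) {h : Vec ℕ (suc (suc n)) → ℕ} →
  Computable[ n ] (f 0) → Computableⁿ (suc (suc n)) h →
  (∀ m xs → uncurryⁿ n (f (suc m)) xs ≡ h (m ∷ uncurryⁿ n (f m) xs ∷ xs)) →
  Computable[ suc n ] f
primrec-computable {n} f {h} (e₀ , ev₀) (eₕ , evₕ) step = R e₀ eₕ , evaluate
  where
  evaluate : ∀ xs → R e₀ eₕ ⟦ xs ⟧⇓ uncurryⁿ (suc n) f xs
  evaluate (zero  ∷ xs) = evR0 (ev₀ xs)
  evaluate (suc m ∷ xs) = evRS (evaluate (m ∷ xs)) (subst (eₕ ⟦ _ ⟧⇓_) (sym (step m xs)) (evₕ _))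

least-witness : ∀ {p} {Q : ℕ → Set p} → Decidable Q → ∀ {w} → Q w →
                ∃ λ y → Q y × (∀ z → z < y → ¬ Q z)
least-witness {Q = Q} Q? {w} Qw = below (suc w) w (n<1+n w) Qw
  where
  below : ∀ b w → w < b → Q w → ∃ λ y → Q y × (∀ z → z < y → ¬ Q z)
  below (suc b) w w<1+b Qw with anyUpTo? Q? w
  ... | no  none             = w , Qw , λ z z<w Qz → none (z , z<w , Qz)
  ... | yes (z , z<w , Qz) = below b z (<-≤-trans z<w (s≤s⁻¹ w<1+b)) Qz

computable-selection : ∀ {n} {q : Vec ℕ (suc n) → ℕ} → Computableⁿ (suc n) q →
  (∀ xs → ∃ λ w → q (w ∷ xs) ≡ 0) →
  ∃ λ (s : Vec ℕ n → ℕ) → Computableⁿ n s × (∀ xs → q (s xs ∷ xs) ≡ 0)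
computable-selection {n} {q} (e , ev) witness =
  s , (M e , λ xs → evM (subst (e ⟦ s xs ∷ xs ⟧⇓_) (s-zero xs) (ev _)) (below-positive xs)) , s-zero
  where
  least : ∀ xs → ∃ λ y → q (y ∷ xs) ≡ 0 × (∀ z → z < y → q (z ∷ xs) ≢ 0)
  least xs = least-witness (λ w → q (w ∷ xs) ≟ 0) (proj₂ (witness xs))

  s : Vec ℕ n → ℕ
  s xs = proj₁ (least xs)

  s-zero : ∀ xs → q (s xs ∷ xs) ≡ 0
  s-zero xs = proj₁ (proj₂ (least xs))

  positive : ∀ {xs v} → e ⟦ xs ⟧⇓ v → v ≢ 0 → ∃ λ w → e ⟦ xs ⟧⇓ suc w
  positive {v = zero}  _  v≢0 = ⊥-elim (v≢0 refl)
  positive {v = suc w} ev _   = w , ev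

  below-positive : ∀ xs z → z < s xs → ∃ λ w → e ⟦ z ∷ xs ⟧⇓ suc w
  below-positive xs z z<s = positive (ev _) (proj₂ (proj₂ (least xs)) z z<s)

infix 0 if0_then_else_
if0_then_else_ : ℕ → ℕ → ℕ → ℕ
if0 zero  then u else v = u
if0 suc _ then u else v = v

if0-zero : ∀ {c u v} → c ≡ 0 → (if0 c then u else v) ≡ u
if0-zero refl = refl

if0-suc : ∀ {c u v} → c ≢ 0 → (if0 c then u else v) ≡ v
if0-suc {zero}  c≢0 = ⊥-elim (c≢0 refl)
if0-suc {suc c} _   = refl

parity : ℕ → ℕ
parity zero    = 0
parity (suc m) = if0 parity m then 1 else 0

half : ℕ → ℕ
half zero    = 0
half (suc m) = half m + parity m

double : ℕ → ℕ
double zero    = 0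
double (suc y) = suc (suc (double y))

+-computable : Computable[ 2 ] _+_
+-computable = primrec-computable _+_ x₀ (suc-computable ∘ᶜ (x₁ ∷ [])) λ _ _ → refl

pred-computable : Computable[ 1 ] pred
pred-computable = primrec-computable pred (const-computable 0) x₀ λ _ _ → refl

∸-computable : Computable[ 2 ] _∸_
∸-computable = flipped ∘ᶜ (x₁ ∷ x₀ ∷ [])
  where
  flipped : Computable[ 2 ] (λ n m → m ∸ n)
  flipped = primrec-computable (λ n m → m ∸ n) x₀ (pred-computable ∘ᶜ (x₁ ∷ []))
              λ n xs → sym (pred[m∸n]≡m∸[1+n] (lookup xs fzero) n)

∣m-n∣≡m∸n+n∸m : ∀ m n → ∣ m - n ∣ ≡ m ∸ n + (n ∸ m)
∣m-n∣≡m∸n+n∸m zero    zero    = refl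
∣m-n∣≡m∸n+n∸m zero    (suc n) = refl
∣m-n∣≡m∸n+n∸m (suc m) zero    = sym (+-identityʳ (suc m))
∣m-n∣≡m∸n+n∸m (suc m) (suc n) = ∣m-n∣≡m∸n+n∸m m n

∣-∣-computable : Computable[ 2 ] ∣_-_∣
∣-∣-computable =
  computable-ext
    (+-computable ∘ᶜ (∸-computable ∘ᶜ (x₀ ∷ x₁ ∷ []) ∷ ∸-computable ∘ᶜ (x₁ ∷ x₀ ∷ []) ∷ []))
                 λ xs → sym (∣m-n∣≡m∸n+n∸m (lookup xs fzero) (lookup xs (fsuc fzero)))

if0-computable : Computable[ 3 ] if0_then_else_
if0-computable = primrec-computable if0_then_else_ x₀ (lookup-computable (# 3))
                   λ { _ (u ∷ v ∷ []) → refl }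

parity-computable : Computable[ 1 ] parity
parity-computable = primrec-computable parity (const-computable 0)
  (if0-computable ∘ᶜ (x₁ ∷ const-computable 1 ∷ const-computable 0 ∷ [])) λ _ _ → refl

half-computable : Computable[ 1 ] half
half-computable = primrec-computable half (const-computable 0)
  (+-computable ∘ᶜ (x₁ ∷ parity-computable ∘ᶜ (x₀ ∷ []) ∷ [])) λ _ _ → refl

double-computable : Computable[ 1 ] double
double-computable = primrec-computable double (const-computable 0)
  (suc-computable ∘ᶜ (suc-computable ∘ᶜ (x₁ ∷ []) ∷ [])) λ _ _ → refl

parity-double : ∀ y → parity (double y) ≡ 0
parity-double zero    = refl
parity-double (suc y) rewrite parity-double y = refl

parity-suc-double : ∀ y → parity (suc (double y)) ≢ 0
parity-suc-double y rewrite parity-double y = λ ()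

half-double : ∀ y → half (double y) ≡ y
half-double zero    = refl
half-double (suc y) rewrite half-double y | parity-double y | +-identityʳ y = +-comm y 1

half-suc-double : ∀ y → half (suc (double y)) ≡ y
half-suc-double y rewrite half-double y | parity-double y = +-identityʳ y

n≤double : ∀ n → n ≤ double n
n≤double zero    = z≤n
n≤double (suc n) = s≤s (m≤n⇒m≤1+n (n≤double n))

even-or-odd : ∀ n → (∃ λ y → n ≡ double y) ⊎ (∃ λ y → n ≡ suc (double y))
even-or-odd zero = inj₁ (0 , refl)
even-or-odd (suc n) with even-or-odd n
... | inj₁ (y , n≡2y)   = inj₂ (y , cong suc n≡2y)
... | inj₂ (y , n≡2y+1) = inj₁ (suc y , cong suc n≡2y+1)

-- Climbs 0, 1, 2, … until twice its value reaches its argument, then restarts at 0.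
sawtooth : ℕ → ℕ
sawtooth zero    = 0
sawtooth (suc m) = if0 m ∸ (sawtooth m + sawtooth m) then 0 else suc (sawtooth m)

sawtooth-computable : Computable[ 1 ] sawtooth
sawtooth-computable = primrec-computable sawtooth (const-computable 0)
  (if0-computable ∘ᶜ ( ∸-computable ∘ᶜ (x₀ ∷ +-computable ∘ᶜ (x₁ ∷ x₁ ∷ []) ∷ [])
                     ∷ const-computable 0
                     ∷ suc-computable ∘ᶜ (x₁ ∷ [])
                     ∷ []))
  λ _ _ → refl

gap : ℕ → ℕ
gap m = m ∸ (sawtooth m + sawtooth m)

gap-decreases : ∀ m {v} → gap m ≡ suc v → gap (suc m) ≡ v
gap-decreases m {v} gap≡1+v = begin
  gap (suc m)             ≡⟨ cong (λ t → suc m ∸ (t + t)) (if0-suc (1+n≢0 ∘ trans (sym gap≡1+v))) ⟩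
  suc m ∸ (suc s + suc s) ≡⟨ cong (m ∸_) (+-suc s s) ⟩
  m ∸ suc (s + s)         ≡⟨ pred[m∸n]≡m∸[1+n] m (s + s) ⟨
  pred (gap m)            ≡⟨ cong pred gap≡1+v ⟩
  v                       ∎
  where s = sawtooth m

sawtooth-resets : ∀ m → ∃ λ m′ → m ≤ m′ × sawtooth m′ ≡ 0
sawtooth-resets m = after (gap m) m refl
  where
  after : ∀ v m → gap m ≡ v → ∃ λ m′ → m ≤ m′ × sawtooth m′ ≡ 0
  after zero    m gap≡0   = suc m , n≤1+n m , if0-zero gap≡0
  after (suc v) m gap≡1+v with after v (suc m) (gap-decreases m gap≡1+v)
  ... | m′ , 1+m≤m′ , reset = m′ , ≤-trans (n≤1+n m) 1+m≤m′ , reset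

sawtooth-climbs : ∀ {m₀} → sawtooth m₀ ≡ 0 → ∀ j → j ≤ m₀ → sawtooth (m₀ + j) ≡ j
sawtooth-climbs {m₀} reset zero    _     = trans (cong sawtooth (+-identityʳ m₀)) reset
sawtooth-climbs {m₀} reset (suc j) j<m₀ = begin
  sawtooth (m₀ + suc j)   ≡⟨ cong sawtooth (+-suc m₀ j) ⟩
  sawtooth (suc (m₀ + j)) ≡⟨ if0-suc gap≢0 ⟩
  suc (sawtooth (m₀ + j)) ≡⟨ cong suc climbed ⟩
  suc j                   ∎
  where
  climbed : sawtooth (m₀ + j) ≡ j
  climbed = sawtooth-climbs reset j (<⇒≤ j<m₀)
  gap≢0 : gap (m₀ + j) ≢ 0
  gap≢0 = subst (λ s → m₀ + j ∸ (s + s) ≢ 0) (sym climbed) (m>n⇒m∸n≢0 (+-monoˡ-< j j<m₀))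

sawtooth-fibres-unbounded : ∀ x N → ∃ λ m → N ≤ m × sawtooth m ≡ x
sawtooth-fibres-unbounded x N with sawtooth-resets (N + x)
... | m₀ , N+x≤m₀ , reset =
  m₀ + x , ≤-trans (m≤m+n N x) (≤-trans N+x≤m₀ (m≤m+n m₀ x)) ,
  sawtooth-climbs reset x (≤-trans (m≤n+m x N) N+x≤m₀)

module InfiniteFibres (h : ℕ → ℕ) (h-computable : Computable[ 1 ] h)
                      (h-fibres-unbounded : ∀ x N → ∃ λ m → N ≤ m × h m ≡ x) where

  anchor : ℕ → ℕ
  anchor k = proj₁ (h-fibres-unbounded k 0)

  h-anchor : ∀ k → h (anchor k) ≡ k
  h-anchor k = proj₂ (proj₂ (h-fibres-unbounded k 0))

  copy : ℕ → ℕ → ℕ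
  copy k m = if0 ∣ h (h m) - k ∣ then h m else anchor k

  copy-computable : ∀ k → Computable[ 1 ] (copy k)
  copy-computable k =
    if0-computable ∘ᶜ ( ∣-∣-computable ∘ᶜ ( h-computable ∘ᶜ (h-computable ∘ᶜ (x₀ ∷ []) ∷ [])
                                          ∷ const-computable k
                                          ∷ [])
                      ∷ h-computable ∘ᶜ (x₀ ∷ [])
                      ∷ const-computable (anchor k)
                      ∷ [])

  copy-on-fibre : ∀ {k m} → h (h m) ≡ k → copy k m ≡ h m
  copy-on-fibre hhm≡k = if0-zero (m≡n⇒∣m-n∣≡0 hhm≡k)

  h-copy : ∀ k m → h (copy k m) ≡ k
  h-copy k m with h (h m) ≟ k
  ... | yes hhm≡k = trans (cong h (copy-on-fibre hhm≡k)) hhm≡k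
  ... | no  hhm≢k = trans (cong h (if0-suc (hhm≢k ∘ ∣m-n∣≡0⇒m≡n))) (h-anchor k)

  decode : ℕ → ℕ → ℕ
  decode k c = if0 parity c then half c else copy k (half c)

  decode-computable : ∀ k → Computable[ 1 ] (decode k)
  decode-computable k =
    if0-computable ∘ᶜ ( parity-computable ∘ᶜ (x₀ ∷ [])
                      ∷ half-computable ∘ᶜ (x₀ ∷ [])
                      ∷ copy-computable k ∘ᶜ (half-computable ∘ᶜ (x₀ ∷ []) ∷ [])
                      ∷ [])

  decode-double : ∀ k y → decode k (double y) ≡ y
  decode-double k y = trans (if0-zero (parity-double y)) (half-double y)

  decode-suc-double : ∀ k m → decode k (suc (double m)) ≡ copy k m
  decode-suc-double k m = trans (if0-suc (parity-suc-double m)) (cong (copy k) (half-suc-double m))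

  B : SubsetOfω → ℕ → SubsetOfω
  B A k c = A (decode k c)

  B≡mA : ∀ A k → B A k ≡m A
  B≡mA A k = (decode k , Computable[1]→Computable (decode-computable k) , λ _ → id , id)
           , (double , Computable[1]→Computable double-computable ,
              λ y → subst A (sym (decode-double k y)) , subst A (decode-double k y))

  module _ {A : SubsetOfω} (A-rigid : mRigid A) {i j : ℕ} (i≢j : i ≢ j) {g : ℕ → ℕ}
           (g-computable : Computable[ 1 ] g) (g-finite-to-one : FiniteToOne g)
           (g-reduces : Reduces g (B A i) (B A j)) where

    avoids : ℕ → ℕ → ℕ
    avoids m x = ∣ h m - x ∣ + (if0 ∣ g (suc (double m)) - double x ∣ then 1 else 0)

    avoids-computable : Computable[ 2 ] avoids
    avoids-computable =
      +-computable ∘ᶜ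
        ( ∣-∣-computable ∘ᶜ (h-computable ∘ᶜ (x₀ ∷ []) ∷ x₁ ∷ [])
        ∷ if0-computable ∘ᶜ
            ( ∣-∣-computable ∘ᶜ ( g-computable ∘ᶜ
                                    (suc-computable ∘ᶜ (double-computable ∘ᶜ (x₀ ∷ []) ∷ []) ∷ [])
                                ∷ double-computable ∘ᶜ (x₁ ∷ [])
                                ∷ [])
            ∷ const-computable 1
            ∷ const-computable 0
            ∷ [])
        ∷ [])

    avoids-witness : ∀ x → ∃ λ m → avoids m x ≡ 0
    avoids-witness x =
      let N , below-N = g-finite-to-one (double x)
          m , N≤m , hm≡x = h-fibres-unbounded x N
          g-misses : g (suc (double m)) ≢ double x
          g-misses g≡2x = <⇒≱ (below-N _ g≡2x) (≤-trans N≤m (m≤n⇒m≤1+n (n≤double m)))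
      in m , cong₂ _+_ (m≡n⇒∣m-n∣≡0 hm≡x) (if0-suc (g-misses ∘ ∣m-n∣≡0⇒m≡n))

    avoids-zero : ∀ {m x} → avoids m x ≡ 0 → h m ≡ x × g (suc (double m)) ≢ double x
    avoids-zero {m} {x} avoids≡0 =
      ∣m-n∣≡0⇒m≡n (m+n≡0⇒m≡0 _ avoids≡0) ,
      λ g≡2x → 1+n≢0 (trans (sym (if0-zero (m≡n⇒∣m-n∣≡0 g≡2x))) (m+n≡0⇒n≡0 _ avoids≡0))

    selection : ∃ λ (s : Vec ℕ 1 → ℕ) → Computableⁿ 1 s × (∀ xs → avoids (s xs) (lookup xs fzero) ≡ 0)
    selection = computable-selection avoids-computable (λ xs → avoids-witness (lookup xs fzero))

    select : ℕ → ℕ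
    select x = proj₁ selection (x ∷ [])

    select-computable : Computable[ 1 ] select
    select-computable = proj₁ (proj₂ selection) ∘ᶜ (x₀ ∷ [])

    h-select : ∀ x → h (select x) ≡ x
    h-select x = proj₁ (avoids-zero (proj₂ (proj₂ selection) (x ∷ [])))

    g-avoids-select : ∀ x → g (suc (double (select x))) ≢ double x
    g-avoids-select x = proj₂ (avoids-zero (proj₂ (proj₂ selection) (x ∷ [])))

    encode : ℕ → ℕ
    encode x = if0 ∣ h x - i ∣ then suc (double (select x)) else double x

    encode-computable : Computable[ 1 ] encode
    encode-computable =
      if0-computable ∘ᶜ ( ∣-∣-computable ∘ᶜ (h-computable ∘ᶜ (x₀ ∷ []) ∷ const-computable i ∷ [])
                        ∷ suc-computable ∘ᶜ
                            (double-computable ∘ᶜ (select-computable ∘ᶜ (x₀ ∷ []) ∷ []) ∷ [])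
                        ∷ double-computable ∘ᶜ (x₀ ∷ [])
                        ∷ [])

    encode-on-fibre : ∀ {x} → h x ≡ i → encode x ≡ suc (double (select x))
    encode-on-fibre hx≡i = if0-zero (m≡n⇒∣m-n∣≡0 hx≡i)

    decode-encode : ∀ x → decode i (encode x) ≡ x
    decode-encode x with h x ≟ i
    ... | yes hx≡i = begin
      decode i (encode x)                  ≡⟨ cong (decode i) (encode-on-fibre hx≡i) ⟩
      decode i (suc (double (select x)))   ≡⟨ decode-suc-double i (select x) ⟩
      copy i (select x)                    ≡⟨ copy-on-fibre (trans (cong h (h-select x)) hx≡i) ⟩
      h (select x)                         ≡⟨ h-select x ⟩
      x                                    ∎
    ... | no hx≢i = trans (cong (decode i) (if0-suc (hx≢i ∘ ∣m-n∣≡0⇒m≡n))) (decode-double i x)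

    f : ℕ → ℕ
    f x = decode j (g (encode x))

    f-computable : Computable[ 1 ] f
    f-computable = decode-computable j ∘ᶜ (g-computable ∘ᶜ (encode-computable ∘ᶜ (x₀ ∷ []) ∷ []) ∷ [])

    f-reduces : Reduces f A A
    f-reduces x =
      (λ Ax → proj₁ (g-reduces (encode x)) (subst A (sym (decode-encode x)) Ax)) ,
      (λ Afx → subst A (decode-encode x) (proj₂ (g-reduces (encode x)) Afx))

    f-moves-fibre : ∀ x → h x ≡ i → f x ≢ x
    f-moves-fibre x hx≡i fx≡x with even-or-odd (g (encode x))
    ... | inj₁ (y , g≡2y) = g-avoids-select x (begin
      g (suc (double (select x))) ≡⟨ cong g (encode-on-fibre hx≡i) ⟨
      g (encode x)                ≡⟨ g≡2y ⟩
      double y                    ≡⟨ cong double y≡x ⟩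
      double x                    ∎)
      where
      y≡x : y ≡ x
      y≡x = trans (sym (decode-double j y)) (trans (cong (decode j) (sym g≡2y)) fx≡x)
    ... | inj₂ (m , g≡2m+1) = i≢j (begin
      i                              ≡⟨ hx≡i ⟨
      h x                            ≡⟨ cong h fx≡x ⟨
      h (decode j (g (encode x)))    ≡⟨ cong (h ∘ decode j) g≡2m+1 ⟩
      h (decode j (suc (double m)))  ≡⟨ cong h (decode-suc-double j m) ⟩
      h (copy j m)                   ≡⟨ h-copy j m ⟩
      j                              ∎)

    reduction-impossible : ⊥
    reduction-impossible =
      let N , f-almost-id = A-rigid f (Computable[1]→Computable f-computable) f-reduces
          x , N≤x , hx≡i = h-fibres-unbounded i N
      in f-moves-fibre x hx≡i (f-almost-id x N≤x)

  B-incomparable : ∀ {A} → mRigid A → ∀ {i j} → i ≢ j → ¬ (B A i ≤fin B A j)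
  B-incomparable A-rigid i≢j (g , g-computable , g-finite-to-one , g-reduces) =
    reduction-impossible A-rigid i≢j (Computable→Computable[1] g-computable) g-finite-to-one g-reduces

corollary5p4 : (A : SubsetOfω) → mRigid A →
    Σ (ℕ → SubsetOfω) λ B →
      (∀ k → B k ≡m A) × (∀ i j → i ≢ j → ¬ (B i ≤fin B j))
corollary5p4 A A-rigid = B A , B≡mA A , λ i j → B-incomparable A-rigid
  where open InfiniteFibres sawtooth sawtooth-computable sawtooth-fibres-unbounded
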